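{- For $i=1,2,3$ let $\mathbf c^{(i)}$ be a composition of a positive integer $n_i$ such that $\mathbf c^{(1)}\oplus\mathbf c^{(2)}\oplus\mathbf c^{(3)}$ is admissible. Suppose $\mathrm{Int}_{u,v}(1+\mathbf c^{(2)})>0$. Then for each $\tau\in Int_{u,v}(1+\mathbf c^{(2)})$ there exists $\sigma\in\mathcal P(\mathbf c^{(1)}\oplus\mathbf c^{(2)}\oplus\mathbf c^{(3)})$ such that $\sigma_{n_1}\sigma_{n_1+1}\cdots\sigma_{n_1+n_2}$ is order-isomorphic to $\tau$.
   Context: Permutations $\sigma\in\mathcal S_n$ are written as words $\sigma_1\cdots\sigma_n$; $i$ is a peak of $\sigma$ if $\sigma_{i-1}<\sigma_i>\sigma_{i+1}$. A composition of $n$ is a finite sequence of positive integers summing to $n$. If the peak set of $\sigma\in\mathcal S_n$ is $\{i_1<\dots<i_k\}$, its peak-composition is $(c_1,\dots,c_{k+1})$, $c_j=i_j-i_{j-1}$, $i_0=0$, $i_{k+1}=n$. $\mathcal P(\mathbf c)$ is the set of permutations of $[n]$ with peak-composition $\mathbf c$ ($n$ the size of $\mathbf c$); $\mathbf c$ is admissible if $\mathcal P(\mathbf c)\neq\emptyset$. $\oplus$ is concatenation. For $\mathbf c=(c_1,\dots,c_k)$, $1+\mathbf c=(c_1+1,c_2,\dots,c_k)$. For a composition $\mathbf c$ of $m$: $Int_{u,v}(\mathbf c)=\{\sigma\in\mathcal P(\mathbf c): u=\sigma_1>\sigma_2,\ \sigma_{m-1}<\sigma_m=v\}$ and $\mathrm{Int}_{u,v}(\mathbf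 c)=\#Int_{u,v}(\mathbf c)$. A word $w_1\cdots w_m$ of distinct integers is order-isomorphic to $\tau\in\mathcal S_m$ if for all $i<j$, $w_i<w_j\iff\tau_i<\tau_j$. -}

module Defs where

open import Data.Nat using (ℕ; zero; suc; _+_; _∸_; _<_; _<ᵇ_)
open import Data.Bool using (Bool; true; false; _∧_; if_then_else_)
open import Data.List using (List; []; _∷_; _++_; map; upTo; length; drop; take)
open import Data.Nat.ListAction using (sum)
open import Data.List.Relation.Unary.All using (All)
open import Data.List.Relation.Binary.Permutation.Propositional using (_↭_)
open import Data.Product using (Σ; _×_; ∃)
open import Relation.Binary.PropositionalEquality using (_≡_)
open import Function.Bundles using (_⇔_)

-- A word of length n (1-indexed: σ₁ ⋯ σₙ) is a permutation of [n] = {1,…,n}.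
IsPerm : ℕ → List ℕ → Set
IsPerm n σ = σ ↭ map suc (upTo n)

IsComposition : List ℕ → Set
IsComposition c = All (λ x → 0 < x) c

-- Peak positions (1-indexed): i with σ_{i-1} < σ_i > σ_{i+1}.
-- peaksFrom i w : w's first letter sits at position i.
peaksFrom : ℕ → List ℕ → List ℕ
peaksFrom i (a ∷ b ∷ c ∷ rest) =
  if (a <ᵇ b) ∧ (c <ᵇ b)
  then suc i ∷ peaksFrom (suc i) (b ∷ c ∷ rest)
  else peaksFrom (suc i) (b ∷ c ∷ rest)
peaksFrom i _ = []

peakSet : List ℕ → List ℕ
peakSet σ = peaksFrom 1 σ

-- differences c_j = i_j - i_{j-1}, with i_0 = prev, i_{k+1} = n
diffs : ℕ → List ℕ → ℕ → List ℕ
diffs prev []       n = (n ∸ prev) ∷ []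
diffs prev (i ∷ is) n = (i ∸ prev) ∷ diffs i is n

peakComp : ℕ → List ℕ → List ℕ
peakComp n σ = diffs 0 (peakSet σ) n

InP : List ℕ → List ℕ → Set
InP c σ = IsPerm (sum c) σ × peakComp (sum c) σ ≡ c

Admissible : List ℕ → Set
Admissible c = ∃ λ σ → InP c σ

onePlus : List ℕ → List ℕ
onePlus []       = []
onePlus (x ∷ xs) = suc x ∷ xs

InInt : ℕ → ℕ → List ℕ → List ℕ → Set
InInt u v c σ =
  InP c σ
  × (∃ λ b → ∃ λ rest → σ ≡ u ∷ b ∷ rest × b < u)
  × (∃ λ pre → ∃ λ a → σ ≡ pre ++ (a ∷ v ∷ []) × a < v)

-- 0-indexed lookup with default 0 (only used for in-range indices)
at : List ℕ → ℕ → ℕ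
at []       _       = 0
at (x ∷ xs) zero    = x
at (x ∷ xs) (suc i) = at xs i

OrderIso : List ℕ → List ℕ → Set
OrderIso w τ =
  length w ≡ length τ
  × (∀ i j → i < j → j < length w → ((at w i < at w j) ⇔ (at τ i < at τ j)))

-- σ_a σ_{a+1} ⋯ σ_b (1-indexed, 1 ≤ a)
factor : ℕ → ℕ → List ℕ → List ℕ
factor a b σ = take (suc b ∸ a) (drop (a ∸ 1) σ)

module Submission where

-- Take σ₀ ∈ 𝒫(c₁ ⊕ c₂ ⊕ c₃).  Its peak set is the list of proper partial sums of
-- c₁ ⊕ c₂ ⊕ c₃, so n₁ and n₁ + n₂ are peaks: the window W = σ₀(n₁) ⋯ σ₀(n₁+n₂) begins and
-- ends at a peak, and the peaks strictly inside W are the partial sums coming from c₂.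
-- Build σ by replacing W with τ lifted above every other letter, and relabelling the
-- letters outside W increasingly onto 1, …, K.  Whether a position is a peak depends only
-- on how adjacent letters compare, so outside the window σ has the peaks of σ₀; both ends
-- of the window remain peaks (τ descends after u, ascends into v, and lies above the
-- outside letters); and inside the window σ has the peaks of τ, which by the hypothesis on
-- τ are again the partial sums coming from c₂.  So σ ∈ 𝒫(c₁ ⊕ c₂ ⊕ c₃), and its factor at
-- positions n₁ … n₁ + n₂ is τ lifted, hence order-isomorphic to τ.

open import Defs
open import Data.Nat using (ℕ; zero; suc; _+_; _∸_; _<_; _≤_; _<ᵇ_; _<?_; z≤n; s≤s; z<s)
open import Data.Nat.Properties
open import Data.Nat.ListAction using (sum)
open import Data.Nat.ListAction.Properties using (sum-++)
open import Data.Nat.Tactic.RingSolver using (solve-∀)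
open import Data.Bool using (Bool; true; false; _∧_; if_then_else_; T)
open import Data.Unit using (tt)
open import Data.Empty using (⊥-elim)
open import Data.Sum using (inj₁; inj₂)
open import Data.Product as Product using (Σ; _×_; ∃; _,_; proj₁; proj₂)
open import Data.List using (List; []; _∷_; _++_; map; length; take; drop; upTo; applyUpTo)
open import Data.List.Properties using (∷-injective; ++-assoc; ++-identityʳ; map-++; length-++; length-map; map-∘; map-id)
open import Data.List.Relation.Unary.All as All using (All; []; _∷_)
open import Data.List.Relation.Unary.All.Properties using (++⁺)
open import Data.List.Relation.Unary.Any using (here; there)
open import Data.List.Relation.Unary.Linked using (Linked; [-]; _∷_)
open import Data.List.Membership.Propositional using (_∈_)
open import Data.List.Membership.Propositional.Properties using (∈-map⁺; ∈-++⁺ˡ; ∈-++⁺ʳ; ∈-++⁻; ∈-insert)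
open import Data.List.Relation.Binary.Permutation.Propositional using (_↭_; ↭-sym; ↭-trans; ↭-reflexive)
open import Data.List.Relation.Binary.Permutation.Propositional.Properties using (∈-resp-↭; ↭-length; drop-mid; ++⁺ˡ; ++-comm; map⁺) renaming (++⁺ to ↭-++⁺)
open import Relation.Binary.PropositionalEquality
open import Relation.Binary.Definitions using (tri<; tri≈; tri>)
open import Relation.Nullary using (¬_; yes; no)
open import Relation.Nullary.Reflects using (of; det; fromEquivalence)
open import Function using (_∘_; id)
open import Function.Bundles using (mk⇔)

cmp : ℕ → ℕ → Bool × Bool
cmp a b = (a <ᵇ b) , (b <ᵇ a)

cmp-< : ∀ {a b} → a < b → cmp a b ≡ (true , false)
cmp-< {a} {b} a<b = cong₂ _,_ (det (<ᵇ-reflects-< a b) (of a<b)) (det (<ᵇ-reflects-< b a) (of (<-asym a<b)))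

cmp-> : ∀ {a b} → b < a → cmp a b ≡ (false , true)
cmp-> {a} {b} b<a = cong₂ _,_ (det (<ᵇ-reflects-< a b) (of (<-asym b<a))) (det (<ᵇ-reflects-< b a) (of b<a))

shape : List ℕ → List (Bool × Bool)
shape (a ∷ b ∷ w) = cmp a b ∷ shape (b ∷ w)
shape _           = []

peaksOfShape : ℕ → List (Bool × Bool) → List ℕ
peaksOfShape i (p ∷ q ∷ s) =
  if proj₁ p ∧ proj₂ q then suc i ∷ peaksOfShape (suc i) (q ∷ s) else peaksOfShape (suc i) (q ∷ s)
peaksOfShape i _ = []

peaks-via-shape : ∀ i w → peaksFrom i w ≡ peaksOfShape i (shape w)
peaks-via-shape i []              = refl
peaks-via-shape i (a ∷ [])        = refl
peaks-via-shape i (a ∷ b ∷ [])    = refl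
peaks-via-shape i (a ∷ b ∷ c ∷ w) =
  cong (λ P → if (a <ᵇ b) ∧ (c <ᵇ b) then suc i ∷ P else P) (peaks-via-shape (suc i) (b ∷ c ∷ w))

peaks-shape : ∀ i w w′ → shape w ≡ shape w′ → peaksFrom i w ≡ peaksFrom i w′
peaks-shape i w w′ eq =
  trans (peaks-via-shape i w) (trans (cong (peaksOfShape i) eq) (sym (peaks-via-shape i w′)))

shape-++ : ∀ X x Y → shape (X ++ x ∷ Y) ≡ shape (X ++ x ∷ []) ++ shape (x ∷ Y)
shape-++ []            x Y = refl
shape-++ (a ∷ [])      x Y = refl
shape-++ (a ∷ b ∷ X)   x Y = cong (cmp a b ∷_) (shape-++ (b ∷ X) x Y)

MonoOn : (ℕ → ℕ) → List ℕ → Set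
MonoOn f w = ∀ {x y} → x ∈ w → y ∈ w → x < y → f x < f y

-- A map that is strictly increasing on letters of w reflects their order, hence keeps cmp.
cmp-mono : ∀ f w {x y} → MonoOn f w → x ∈ w → y ∈ w → cmp (f x) (f y) ≡ cmp x y
cmp-mono f w {x} {y} mono x∈ y∈ = cong₂ _,_ (ltᵇ-same x∈ y∈) (ltᵇ-same y∈ x∈)
  where
  reflect : ∀ {p q} → p ∈ w → q ∈ w → f p < f q → p < q
  reflect {p} {q} p∈ q∈ fp<fq with <-cmp p q
  ... | tri< p<q _ _  = p<q
  ... | tri≈ _ refl _ = ⊥-elim (<-irrefl refl fp<fq)
  ... | tri> _ _ q<p  = ⊥-elim (<-asym fp<fq (mono q∈ p∈ q<p))
  ltᵇ-same : ∀ {p q} → p ∈ w → q ∈ w → (f p <ᵇ f q) ≡ (p <ᵇ q)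
  ltᵇ-same {p} {q} p∈ q∈ =
    det (<ᵇ-reflects-< (f p) (f q)) (fromEquivalence (mono p∈ q∈ ∘ <ᵇ⇒< p q) (<⇒<ᵇ ∘ reflect p∈ q∈))

shape-map : ∀ f w → MonoOn f w → shape (map f w) ≡ shape w
shape-map f []          mono = refl
shape-map f (a ∷ [])    mono = refl
shape-map f (a ∷ b ∷ w) mono =
  cong₂ _∷_ (cmp-mono f (a ∷ b ∷ w) mono (here refl) (there (here refl)))
            (shape-map f (b ∷ w) (λ x∈ y∈ → mono (there x∈) (there y∈)))

-- Peeling off the first letter: the only peak that sees a is the one at the next position.
peaks-head : ∀ i a w → peaksFrom i (a ∷ w) ≡ peaksFrom i (a ∷ take 2 w) ++ peaksFrom (suc i) w
peaks-head i a []          = refl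
peaks-head i a (b ∷ [])    = refl
peaks-head i a (b ∷ c ∷ w) with (a <ᵇ b) ∧ (c <ᵇ b)
... | true  = refl
... | false = refl

take₂-++ : ∀ X (x y : ℕ) Y → take 2 (X ++ x ∷ y ∷ Y) ≡ take 2 (X ++ x ∷ y ∷ [])
take₂-++ []            x y Y = refl
take₂-++ (a ∷ [])      x y Y = refl
take₂-++ (a ∷ b ∷ X)   x y Y = refl

peaks-split : ∀ i X x y Y →
  peaksFrom i (X ++ x ∷ y ∷ Y) ≡ peaksFrom i (X ++ x ∷ y ∷ []) ++ peaksFrom (i + length X) (x ∷ y ∷ Y)
peaks-split i [] x y Y = cong (λ j → peaksFrom j (x ∷ y ∷ Y)) (sym (+-identityʳ i))
peaks-split i (a ∷ X) x y Y = begin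
    peaksFrom i (a ∷ X ++ x ∷ y ∷ Y)
  ≡⟨ peaks-head i a (X ++ x ∷ y ∷ Y) ⟩
    peaksFrom i (a ∷ take 2 (X ++ x ∷ y ∷ Y)) ++ peaksFrom (suc i) (X ++ x ∷ y ∷ Y)
  ≡⟨ cong₂ _++_ (cong (λ t → peaksFrom i (a ∷ t)) (take₂-++ X x y Y)) (peaks-split (suc i) X x y Y) ⟩
    peaksFrom i (a ∷ take 2 (X ++ x ∷ y ∷ []))
      ++ (peaksFrom (suc i) (X ++ x ∷ y ∷ []) ++ peaksFrom (suc i + length X) (x ∷ y ∷ Y))
  ≡⟨ sym (++-assoc (peaksFrom i (a ∷ take 2 (X ++ x ∷ y ∷ []))) _ _) ⟩
    (peaksFrom i (a ∷ take 2 (X ++ x ∷ y ∷ [])) ++ peaksFrom (suc i) (X ++ x ∷ y ∷ []))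
      ++ peaksFrom (suc i + length X) (x ∷ y ∷ Y)
  ≡⟨ cong₂ _++_ (sym (peaks-head i a (X ++ x ∷ y ∷ [])))
                (cong (λ j → peaksFrom j (x ∷ y ∷ Y)) (sym (+-suc i (length X)))) ⟩
    peaksFrom i (a ∷ X ++ x ∷ y ∷ []) ++ peaksFrom (i + suc (length X)) (x ∷ y ∷ Y)
  ∎
  where open ≡-Reasoning

peaks-cut : ∀ i X x y z Y →
  peaksFrom i (X ++ x ∷ y ∷ z ∷ Y) ≡
    peaksFrom i (X ++ x ∷ y ∷ []) ++ peaksFrom (i + length X) (x ∷ y ∷ z ∷ [])
      ++ peaksFrom (suc (i + length X)) (y ∷ z ∷ Y)
peaks-cut i X x y z Y =
  trans (peaks-split i X x y (z ∷ Y)) (cong (peaksFrom i (X ++ x ∷ y ∷ []) ++_) (peaks-head _ x (y ∷ z ∷ Y)))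

peak₃-intro : ∀ {i a b c} → a < b → c < b → peaksFrom i (a ∷ b ∷ c ∷ []) ≡ suc i ∷ []
peak₃-intro {i} {a} {b} {c} a<b c<b
  rewrite det (<ᵇ-reflects-< a b) (of a<b) | det (<ᵇ-reflects-< c b) (of c<b) = refl

peak₃-elim : ∀ {i a b c} → peaksFrom i (a ∷ b ∷ c ∷ []) ≡ suc i ∷ [] → a < b × c < b
peak₃-elim {i} {a} {b} {c} eq with a <ᵇ b in a<ᵇb | c <ᵇ b in c<ᵇb
peak₃-elim eq | true  | true  = <ᵇ⇒< _ _ (subst T (sym a<ᵇb) tt) , <ᵇ⇒< _ _ (subst T (sym c<ᵇb) tt)
peak₃-elim () | true  | false
peak₃-elim () | false | _

peak₃-at : ∀ i a b c → All (_≡ suc i) (peaksFrom i (a ∷ b ∷ c ∷ []))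
peak₃-at i a b c with (a <ᵇ b) ∧ (c <ᵇ b)
... | true  = refl ∷ []
... | false = []

peaks-above : ∀ i w → All (i <_) (peaksFrom i w)
peaks-above i []              = []
peaks-above i (a ∷ [])        = []
peaks-above i (a ∷ b ∷ [])    = []
peaks-above i (a ∷ b ∷ c ∷ w) = subst (All (i <_)) (sym (peaks-head i a (b ∷ c ∷ w)))
  (++⁺ (All.map (λ { refl → n<1+n i }) (peak₃-at i a b c))
       (All.map (<-trans (n<1+n i)) (peaks-above (suc i) (b ∷ c ∷ w))))

peaks-below : ∀ i w → All (λ p → suc p < i + length w) (peaksFrom i w)
peaks-below i []              = []
peaks-below i (a ∷ [])        = []
peaks-below i (a ∷ b ∷ [])    = []
peaks-below i (a ∷ b ∷ c ∷ w) = subst (All (λ p → suc p < i + length (a ∷ b ∷ c ∷ w)))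
  (sym (peaks-head i a (b ∷ c ∷ w)))
  (++⁺ (All.map (λ { refl → middle }) (peak₃-at i a b c))
       (All.map (λ {p} → subst (suc p <_) (sym (+-suc i _))) (peaks-below (suc i) (b ∷ c ∷ w))))
  where
  middle : suc (suc i) < i + length (a ∷ b ∷ c ∷ w)
  middle = subst (suc (suc i) <_) (+-comm (length (a ∷ b ∷ c ∷ w)) i) (s≤s (s≤s (s≤s (m≤n+m i _))))

peaks-shift : ∀ k i w → peaksFrom (k + i) w ≡ map (k +_) (peaksFrom i w)
peaks-shift k i []              = refl
peaks-shift k i (a ∷ [])        = refl
peaks-shift k i (a ∷ b ∷ [])    = refl
peaks-shift k i (a ∷ b ∷ c ∷ w) = begin
    peaksFrom (k + i) (a ∷ b ∷ c ∷ w)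
  ≡⟨ peaks-head (k + i) a (b ∷ c ∷ w) ⟩
    peaksFrom (k + i) (a ∷ b ∷ c ∷ []) ++ peaksFrom (suc (k + i)) (b ∷ c ∷ w)
  ≡⟨ cong₂ _++_ peaks₃-shift
       (trans (cong (λ j → peaksFrom j (b ∷ c ∷ w)) (sym (+-suc k i))) (peaks-shift k (suc i) (b ∷ c ∷ w))) ⟩
    map (k +_) (peaksFrom i (a ∷ b ∷ c ∷ [])) ++ map (k +_) (peaksFrom (suc i) (b ∷ c ∷ w))
  ≡⟨ sym (map-++ (k +_) (peaksFrom i (a ∷ b ∷ c ∷ [])) _) ⟩
    map (k +_) (peaksFrom i (a ∷ b ∷ c ∷ []) ++ peaksFrom (suc i) (b ∷ c ∷ w))
  ≡⟨ cong (map (k +_)) (sym (peaks-head i a (b ∷ c ∷ w))) ⟩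
    map (k +_) (peaksFrom i (a ∷ b ∷ c ∷ w))
  ∎
  where
  open ≡-Reasoning
  peaks₃-shift : peaksFrom (k + i) (a ∷ b ∷ c ∷ []) ≡ map (k +_) (peaksFrom i (a ∷ b ∷ c ∷ []))
  peaks₃-shift with (a <ᵇ b) ∧ (c <ᵇ b)
  ... | true  = cong (_∷ []) (sym (+-suc k i))
  ... | false = refl

lower-start : ∀ {lo lo′ P} → lo < lo′ → Linked _<_ (lo′ ∷ P) → Linked _<_ (lo ∷ P)
lower-start lo<lo′ [-]         = [-]
lower-start lo<lo′ (lo′<p ∷ l) = <-trans lo<lo′ lo′<p ∷ l

peaks-ascending : ∀ i w → Linked _<_ (i ∷ peaksFrom i w)
peaks-ascending i []              = [-]
peaks-ascending i (a ∷ [])        = [-]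
peaks-ascending i (a ∷ b ∷ [])    = [-]
peaks-ascending i (a ∷ b ∷ c ∷ w) = step ((a <ᵇ b) ∧ (c <ᵇ b)) (peaks-ascending (suc i) (b ∷ c ∷ w))
  where
  step : ∀ β {P} → Linked _<_ (suc i ∷ P) → Linked _<_ (i ∷ (if β then suc i ∷ P else P))
  step true  asc = n<1+n i ∷ asc
  step false asc = lower-start (n<1+n i) asc

-- partialSums o c lists o + c₁, o + c₁ + c₂, …, omitting the full sum: the peak set
-- prescribed by the peak-composition c.
partialSums : ℕ → List ℕ → List ℕ
partialSums o []          = []
partialSums o (x ∷ [])    = []
partialSums o (x ∷ y ∷ c) = o + x ∷ partialSums (o + x) (y ∷ c)

-- The difference list of an ascending list is nonempty, so partialSums unfolds over it.
partialSums-diffs : ∀ o x lo P n →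
  partialSums o (x ∷ diffs lo P n) ≡ o + x ∷ partialSums (o + x) (diffs lo P n)
partialSums-diffs o x lo []      n = refl
partialSums-diffs o x lo (p ∷ P) n = refl

diffs-inverse : ∀ {lo P} n → Linked _<_ (lo ∷ P) → P ≡ partialSums lo (diffs lo P n)
diffs-inverse {lo} {[]}    n _             = refl
diffs-inverse {lo} {p ∷ P} n (lo<p ∷ asc) = begin
    p ∷ P
  ≡⟨ cong (p ∷_) (diffs-inverse n asc) ⟩
    p ∷ partialSums p (diffs p P n)
  ≡⟨ cong (λ q → q ∷ partialSums q (diffs p P n)) (sym (m+[n∸m]≡n (<⇒≤ lo<p))) ⟩
    lo + (p ∸ lo) ∷ partialSums (lo + (p ∸ lo)) (diffs p P n)
  ≡⟨ sym (partialSums-diffs lo (p ∸ lo) p P n) ⟩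
    partialSums lo (diffs lo (p ∷ P) n)
  ∎
  where open ≡-Reasoning

peakSet-of-peakComp : ∀ n σ c → peakComp n σ ≡ c → peakSet σ ≡ partialSums 0 c
peakSet-of-peakComp n σ c eq =
  trans (diffs-inverse n (lower-start z<s (peaks-ascending 1 σ))) (cong (partialSums 0) eq)

partialSums-++ : ∀ o x c y d →
  partialSums o (x ∷ c ++ y ∷ d) ≡
    partialSums o (x ∷ c) ++ o + sum (x ∷ c) ∷ partialSums (o + sum (x ∷ c)) (y ∷ d)
partialSums-++ o x []      y d = cong (λ s → o + s ∷ partialSums (o + s) (y ∷ d)) (sym (+-identityʳ x))
partialSums-++ o x (z ∷ c) y d = cong (o + x ∷_) (trans (partialSums-++ (o + x) z c y d)
  (cong (λ s → partialSums (o + x) (z ∷ c) ++ s ∷ partialSums s (y ∷ d)) (+-assoc o x (sum (z ∷ c)))))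

partialSums-shift : ∀ k o c → map (k +_) (partialSums o c) ≡ partialSums (k + o) c
partialSums-shift k o []          = refl
partialSums-shift k o (x ∷ [])    = refl
partialSums-shift k o (x ∷ y ∷ c) = cong₂ _∷_ (sym (+-assoc k o x))
  (trans (partialSums-shift k (o + x) (y ∷ c)) (cong (λ s → partialSums s (y ∷ c)) (sym (+-assoc k o x))))

-- Moving one unit from the first part into the offset: the passage between c and 1 + c.
partialSums-suc : ∀ o x c → partialSums o (suc x ∷ c) ≡ partialSums (suc o) (x ∷ c)
partialSums-suc o x []      = refl
partialSums-suc o x (y ∷ c) = cong (λ s → s ∷ partialSums s (y ∷ c)) (+-suc o x)

partialSums-bounds : ∀ o c → IsComposition c → All (λ p → o < p × p < o + sum c) (partialSums o c)
partialSums-bounds o []          _                = []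
partialSums-bounds o (x ∷ [])    _                = []
partialSums-bounds o (x ∷ y ∷ c) (x>0 ∷ y>0 ∷ pos) =
  (o<o+x , +-monoʳ-< o (m<m+n x (≤-trans y>0 (m≤m+n y (sum c)))))
  ∷ All.map (λ {p} (o+x<p , p<) → <-trans o<o+x o+x<p , subst (p <_) (+-assoc o x _) p<)
            (partialSums-bounds (o + x) (y ∷ c) (y>0 ∷ pos))
  where
  o<o+x : o < o + x
  o<o+x = m<m+n o x>0

split-at : ∀ t X Y {R R′ : List ℕ} → All (_< t) X → All (_< t) Y → All (t ≤_) R → All (t ≤_) R′ →
  X ++ R ≡ Y ++ R′ → X ≡ Y × R ≡ R′
split-at t []      []      _          _          _   _    eq = refl , eq
split-at t []      (y ∷ Y) _          (y<t ∷ _)  t≤R _    eq = ⊥-elim (<⇒≱ y<t (All.head (subst (All (t ≤_)) eq t≤R)))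
split-at t (x ∷ X) []      (x<t ∷ _)  _          _   t≤R′ eq = ⊥-elim (<⇒≱ x<t (All.head (subst (All (t ≤_)) (sym eq) t≤R′)))
split-at t (x ∷ X) (y ∷ Y) (_ ∷ X<t)  (_ ∷ Y<t)  t≤R t≤R′ eq with ∷-injective eq
... | refl , eq′ = Product.map (cong (x ∷_)) id (split-at t X Y X<t Y<t t≤R t≤R′ eq′)

record Banded (s e : ℕ) (L S M E R : List ℕ) : Set where
  field
    below   : All (_< s) L
    at-s    : All (_≡ s) S
    between : All (λ p → s < p × p < e) M
    at-e    : All (_≡ e) E
    above   : All (e <_) R

  -- the bounds used to split the bands off one at a time
  past-s : s < e → All (s <_) (M ++ E ++ R)
  past-s s<e = ++⁺ (All.map proj₁ between)
                   (++⁺ (All.map (λ p≡e → subst (s <_) (sym p≡e) s<e) at-e) (All.map (<-trans s<e) above))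

  from-s : s < e → All (s ≤_) (S ++ M ++ E ++ R)
  from-s s<e = ++⁺ (All.map (≤-reflexive ∘ sym) at-s) (All.map <⇒≤ (past-s s<e))

  from-e : All (e ≤_) (E ++ R)
  from-e = ++⁺ (All.map (≤-reflexive ∘ sym) at-e) (All.map <⇒≤ above)

  at-s-below : All (_< suc s) S
  at-s-below = All.map (s≤s ∘ ≤-reflexive) at-s

  at-e-below : All (_< suc e) E
  at-e-below = All.map (s≤s ∘ ≤-reflexive) at-e

banded-unique : ∀ {s e L S M E R L′ S′ M′ E′ R′} → s < e →
  Banded s e L S M E R → Banded s e L′ S′ M′ E′ R′ →
  L ++ S ++ M ++ E ++ R ≡ L′ ++ S′ ++ M′ ++ E′ ++ R′ →
  L ≡ L′ × S ≡ S′ × M ≡ M′ × E ≡ E′ × R ≡ R′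
banded-unique {s} {e} s<e b b′ eq =
  let L≡ , eq₁ = split-at s _ _ (below b) (below b′) (from-s b s<e) (from-s b′ s<e) eq
      S≡ , eq₂ = split-at (suc s) _ _ (at-s-below b) (at-s-below b′) (past-s b s<e) (past-s b′ s<e) eq₁
      M≡ , eq₃ = split-at e _ _ (All.map proj₂ (between b)) (All.map proj₂ (between b′)) (from-e b) (from-e b′) eq₂
      E≡ , R≡ = split-at (suc e) _ _ (at-e-below b) (at-e-below b′) (above b) (above b′) eq₃
  in L≡ , S≡ , M≡ , E≡ , R≡
  where open Banded

-- A word of length at least two, seen both from its front and from its back.
record Ends : Set where
  constructor framed
  field
    first second : ℕ
    inner        : List ℕ
    init         : List ℕ
    penult last  : ℕ
    frame        : first ∷ second ∷ inner ≡ init ++ penult ∷ last ∷ []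

  letters : List ℕ
  letters = first ∷ second ∷ inner

  length-letters : length letters ≡ suc (suc (length init))
  length-letters = trans (cong length frame)
    (trans (length-++ init) (trans (+-suc (length init) 1) (cong suc (+-comm (length init) 1))))

record Window : Set where
  field
    A : List ℕ
    a : ℕ
    W : Ends
    b : ℕ
    B : List ℕ
  open Ends W

  word : List ℕ
  word = A ++ a ∷ letters ++ b ∷ B

  -- positions of the first and the last letter of the window
  start end : ℕ
  start = suc (suc (length A))
  end   = suc (start + length init)

  -- the peak set cut into five pieces: before the window, at its start,
  -- strictly inside, at its end, after it
  left entry mid exit right : List ℕ
  left  = peaksFrom 1 (A ++ a ∷ first ∷ [])
  entry = peaksFrom (suc (length A)) (a ∷ first ∷ second ∷ [])
  mid   = peaksFrom start letters
  exit  = peaksFrom (start + length init) (penult ∷ last ∷ b ∷ [])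
  right = peaksFrom end (last ∷ b ∷ B)

  PeakEnds : Set
  PeakEnds = (a < first × second < first) × (penult < last × b < last)

peaks-window : ∀ c → let open Window c in peakSet word ≡ left ++ entry ++ mid ++ exit ++ right
peaks-window c = begin
    peakSet (A ++ a ∷ first ∷ second ∷ inner ++ b ∷ B)
  ≡⟨ peaks-cut 1 A a first second (inner ++ b ∷ B) ⟩
    left ++ entry ++ peaksFrom start (first ∷ second ∷ inner ++ b ∷ B)
  ≡⟨ cong (λ w → left ++ entry ++ peaksFrom start w) rest≡ ⟩
    left ++ entry ++ peaksFrom start (init ++ penult ∷ last ∷ b ∷ B)
  ≡⟨ cong (λ P → left ++ entry ++ P) (peaks-cut start init penult last b B) ⟩
    left ++ entry ++ peaksFrom start (init ++ penult ∷ last ∷ []) ++ exit ++ right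
  ≡⟨ cong (λ w → left ++ entry ++ peaksFrom start w ++ exit ++ right) (sym frame) ⟩
    left ++ entry ++ mid ++ exit ++ right
  ∎
  where
  open ≡-Reasoning
  open Window c
  open Ends W
  rest≡ : first ∷ second ∷ inner ++ b ∷ B ≡ init ++ penult ∷ last ∷ b ∷ B
  rest≡ = trans (cong (_++ b ∷ B) frame) (++-assoc init (penult ∷ last ∷ []) (b ∷ B))

window-banded : ∀ c → let open Window c in Banded start end left entry mid exit right
window-banded c = record
  { below   = All.map (λ {p} p< → ≤-pred (subst (suc p <_) left-length p<)) (peaks-below 1 (A ++ a ∷ first ∷ []))
  ; at-s    = peak₃-at (suc (length A)) a first second
  ; between = All.zip (peaks-above start letters
                      , All.map (λ {p} p< → ≤-pred (subst (suc p <_) mid-length p<)) (peaks-below start letters))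
  ; at-e    = peak₃-at (start + length init) penult last b
  ; above   = peaks-above end (last ∷ b ∷ B)
  }
  where
  open Window c
  open Ends W
  left-length : 1 + length (A ++ a ∷ first ∷ []) ≡ suc start
  left-length = cong suc (trans (length-++ A) (trans (+-suc (length A) 1) (cong suc (+-comm (length A) 1))))
  mid-length : start + length letters ≡ suc end
  mid-length = trans (cong (start +_) length-letters) (trans (+-suc start _) (cong suc (+-suc start _)))

-- The window has at least two letters.
start<end : ∀ c → Window.start c < Window.end c
start<end c = s≤s (m≤m+n _ _)

window-peaks : ∀ c {L M R} → let open Window c in
  peakSet word ≡ L ++ start ∷ M ++ end ∷ R →
  Banded start end L (start ∷ []) M (end ∷ []) R →
  PeakEnds × mid ≡ M
window-peaks c eq banded
  with banded-unique (start<end c) (window-banded c) banded (trans (sym (peaks-window c)) eq)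
... | _ , entry≡ , mid≡ , exit≡ , _ = (peak₃-elim entry≡ , peak₃-elim exit≡) , mid≡

record SameOutside (c c′ : Window) : Set where
  private module C = Window c; module C′ = Window c′
  field
    same-start   : length C.A ≡ length C′.A
    same-init    : length (Ends.init C.W) ≡ length (Ends.init C′.W)
    shape-before : shape (C.A ++ C.a ∷ []) ≡ shape (C′.A ++ C′.a ∷ [])
    shape-after  : shape (C.b ∷ C.B) ≡ shape (C′.b ∷ C′.B)

replace-window : ∀ c c′ → Window.PeakEnds c → Window.PeakEnds c′ → SameOutside c c′ →
  Window.mid c ≡ Window.mid c′ → peakSet (Window.word c) ≡ peakSet (Window.word c′)
replace-window c c′ ((a< , <f) , (p< , b<)) ((a<′ , <f′) , (p<′ , b<′)) same mid≡ = begin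
    peakSet C.word
  ≡⟨ peaks-window c ⟩
    C.left ++ C.entry ++ C.mid ++ C.exit ++ C.right
  ≡⟨ cong₂ _++_ left≡ (cong₂ _++_ entry≡ (cong₂ _++_ mid≡ (cong₂ _++_ exit≡ right≡))) ⟩
    C′.left ++ C′.entry ++ C′.mid ++ C′.exit ++ C′.right
  ≡⟨ sym (peaks-window c′) ⟩
    peakSet C′.word
  ∎
  where
  open ≡-Reasoning
  open SameOutside same
  module C = Window c
  module C′ = Window c′
  start≡ : C.start ≡ C′.start
  start≡ = cong (λ n → suc (suc n)) same-start
  end≡ : C.end ≡ C′.end
  end≡ = cong suc (cong₂ _+_ start≡ same-init)
  left≡ : C.left ≡ C′.left
  left≡ = peaks-shape 1 _ _ (begin
      shape (C.A ++ C.a ∷ Ends.first C.W ∷ [])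
    ≡⟨ shape-++ C.A C.a _ ⟩
      shape (C.A ++ C.a ∷ []) ++ cmp C.a (Ends.first C.W) ∷ []
    ≡⟨ cong₂ (λ s q → s ++ q ∷ []) shape-before (trans (cmp-< a<) (sym (cmp-< a<′))) ⟩
      shape (C′.A ++ C′.a ∷ []) ++ cmp C′.a (Ends.first C′.W) ∷ []
    ≡⟨ sym (shape-++ C′.A C′.a _) ⟩
      shape (C′.A ++ C′.a ∷ Ends.first C′.W ∷ [])
    ∎)
  entry≡ : C.entry ≡ C′.entry
  entry≡ = trans (peak₃-intro a< <f) (trans (cong (_∷ []) start≡) (sym (peak₃-intro a<′ <f′)))
  exit≡ : C.exit ≡ C′.exit
  exit≡ = trans (peak₃-intro p< b<) (trans (cong (_∷ []) end≡) (sym (peak₃-intro p<′ b<′)))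
  right≡ : C.right ≡ C′.right
  right≡ = trans (cong (λ i → peaksFrom i (Ends.last C.W ∷ C.b ∷ C.B)) end≡)
                 (peaks-shape C′.end _ _ (cong₂ _∷_ (trans (cmp-> b<) (sym (cmp-> b<′))) shape-after))

drop-past : ∀ (X : List ℕ) x Y → drop (suc (length X)) (X ++ x ∷ Y) ≡ Y
drop-past []      x Y = refl
drop-past (_ ∷ X) x Y = drop-past X x Y

take-++ : ∀ (X Y : List ℕ) → take (length X) (X ++ Y) ≡ X
take-++ []      Y = refl
take-++ (x ∷ X) Y = cong (x ∷_) (take-++ X Y)

factor-window : ∀ c → let open Window c in factor start end word ≡ Ends.letters W
factor-window c = begin
    take (suc end ∸ start) (drop (suc (length A)) (A ++ a ∷ letters ++ b ∷ B))
  ≡⟨ cong (take (suc end ∸ start)) (drop-past A a (letters ++ b ∷ B)) ⟩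
    take (suc end ∸ start) (letters ++ b ∷ B)
  ≡⟨ cong (λ n → take n (letters ++ b ∷ B)) window-length ⟩
    take (length letters) (letters ++ b ∷ B)
  ≡⟨ take-++ letters (b ∷ B) ⟩
    letters
  ∎
  where
  open ≡-Reasoning
  open Window c
  open Ends W
  window-length : suc end ∸ start ≡ length letters
  window-length = begin
      suc (suc (start + length init)) ∸ start
    ≡⟨ cong (_∸ start) (sym (trans (+-suc start _) (cong suc (+-suc start _)))) ⟩
      start + suc (suc (length init)) ∸ start
    ≡⟨ m+n∸m≡n start _ ⟩
      suc (suc (length init))
    ≡⟨ sym length-letters ⟩
      length letters
    ∎

interval : ℕ → ℕ → List ℕ
interval a zero    = []
interval a (suc k) = suc a ∷ interval (suc a) k

length-interval : ∀ a k → length (interval a k) ≡ k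
length-interval a zero    = refl
length-interval a (suc k) = cong suc (length-interval (suc a) k)

interval-++ : ∀ a k l → interval a (k + l) ≡ interval a k ++ interval (a + k) l
interval-++ a zero    l = cong (λ b → interval b l) (sym (+-identityʳ a))
interval-++ a (suc k) l = cong (suc a ∷_) (trans (interval-++ (suc a) k l)
  (cong (λ b → interval (suc a) k ++ interval b l) (sym (+-suc a k))))

interval-∈ : ∀ a k {x} → x ∈ interval a k → a < x × x ≤ a + k
interval-∈ a (suc k) (here refl) = n<1+n a , subst (suc a ≤_) (sym (+-suc a k)) (s≤s (m≤m+n a k))
interval-∈ a (suc k) (there x∈) with interval-∈ (suc a) k x∈
... | a<x , x≤ = <-trans (n<1+n a) a<x , subst (_≤_ _) (sym (+-suc a k)) x≤

interval-shift : ∀ K a k → map (K +_) (interval a k) ≡ interval (K + a) k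
interval-shift K a zero    = refl
interval-shift K a (suc k) = cong₂ _∷_ (+-suc K a) (trans (interval-shift K (suc a) k) (cong (λ b → interval b k) (+-suc K a)))

upTo-interval : ∀ n → map suc (upTo n) ≡ interval 0 n
upTo-interval n = go id 0 n (λ _ → refl)
  where
  go : ∀ f a n → (∀ i → f i ≡ a + i) → map suc (applyUpTo f n) ≡ interval a n
  go f a zero    f≡ = refl
  go f a (suc n) f≡ = cong₂ _∷_ (cong suc (trans (f≡ 0) (+-identityʳ a)))
    (go (f ∘ suc) (suc a) n (λ i → trans (f≡ (suc i)) (+-suc a i)))

perm-length : ∀ {n σ} → IsPerm n σ → length σ ≡ n
perm-length {n} perm = trans (↭-length perm) (trans (cong length (upTo-interval n)) (length-interval 0 n))

-- squeeze w closes the gap left by deleting the letter w: letters above w move down by one.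
squeeze : ℕ → ℕ → ℕ
squeeze w x = if x <ᵇ w then x else x ∸ 1

squeeze-fixes : ∀ {w x} → x < w → squeeze w x ≡ x
squeeze-fixes {w} {x} x<w rewrite det (<ᵇ-reflects-< x w) (of x<w) = refl

squeeze-lowers : ∀ {w x} → ¬ x < w → squeeze w x ≡ x ∸ 1
squeeze-lowers {w} {x} x≮w rewrite det (<ᵇ-reflects-< x w) (of x≮w) = refl

squeeze-below : ∀ p a k → a + k ≤ p → map (squeeze (suc p)) (interval a k) ≡ interval a k
squeeze-below p a zero    _  = refl
squeeze-below p a (suc k) le = cong₂ _∷_ (squeeze-fixes (s≤s (≤-trans (s≤s (m≤m+n a k)) le′)))
                                         (squeeze-below p (suc a) k le′)
  where
  le′ : suc a + k ≤ p
  le′ = subst (_≤ p) (+-suc a k) le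

squeeze-above : ∀ p a k → p ≤ a → map (squeeze (suc p)) (interval (suc a) k) ≡ interval a k
squeeze-above p a zero    _  = refl
squeeze-above p a (suc k) le = cong₂ _∷_ (squeeze-lowers (λ lt → <⇒≱ lt (s≤s (m≤n⇒m≤1+n le))))
                                         (squeeze-above p (suc a) k (m≤n⇒m≤1+n le))

squeeze-mono : ∀ {w x y} → 0 < w → x ≢ w → y ≢ w → x < y → squeeze w x < squeeze w y
squeeze-mono {w} {x} {y} w>0 x≢w y≢w x<y with x <? w | y <? w
... | yes x<w | yes y<w rewrite squeeze-fixes x<w | squeeze-fixes y<w = x<y
... | yes x<w | no  y≮w rewrite squeeze-fixes x<w | squeeze-lowers y≮w =
  <-≤-trans x<w (below-pred (≤∧≢⇒< (≮⇒≥ y≮w) (y≢w ∘ sym)))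
  where below-pred : ∀ {m n} → m < n → m ≤ n ∸ 1
        below-pred {n = suc n} (s≤s m≤n) = m≤n
... | no  x≮w | yes y<w = ⊥-elim (x≮w (<-trans x<y y<w))
... | no  x≮w | no  y≮w rewrite squeeze-lowers x≮w | squeeze-lowers y≮w =
  ∸-monoˡ-< x<y (<-≤-trans w>0 (≮⇒≥ x≮w))

remove-letter : ∀ X Z w N → X ++ w ∷ Z ↭ interval 0 (suc N) →
  map (squeeze w) (X ++ Z) ↭ interval 0 N × (∀ {x} → x ∈ X → x ≢ w) × 0 < w
remove-letter X Z w N perm with interval-∈ 0 (suc N) (∈-resp-↭ perm (∈-insert X))
remove-letter X Z (suc p) N perm | _ , w≤ = squeezed , distinct , z<s
  where
  q = N ∸ p
  p+q≡N : p + q ≡ N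
  p+q≡N = m+[n∸m]≡n (≤-pred w≤)
  split : interval 0 (suc N) ≡ interval 0 p ++ suc p ∷ interval (suc p) q
  split = trans (cong (interval 0) (sym (trans (+-suc p q) (cong suc p+q≡N)))) (interval-++ 0 p (suc q))
  rest : X ++ Z ↭ interval 0 p ++ interval (suc p) q
  rest = drop-mid X (interval 0 p) (↭-trans perm (↭-reflexive split))
  squeezed : map (squeeze (suc p)) (X ++ Z) ↭ interval 0 N
  squeezed = ↭-trans (map⁺ (squeeze (suc p)) rest) (↭-reflexive (begin
      map (squeeze (suc p)) (interval 0 p ++ interval (suc p) q)
    ≡⟨ map-++ (squeeze (suc p)) (interval 0 p) _ ⟩
      map (squeeze (suc p)) (interval 0 p) ++ map (squeeze (suc p)) (interval (suc p) q)
    ≡⟨ cong₂ _++_ (squeeze-below p 0 p ≤-refl) (squeeze-above p p q ≤-refl) ⟩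
      interval 0 p ++ interval p q
    ≡⟨ sym (interval-++ 0 p q) ⟩
      interval 0 (p + q)
    ≡⟨ cong (interval 0) p+q≡N ⟩
      interval 0 N
    ∎))
    where open ≡-Reasoning
  distinct : ∀ {x} → x ∈ X → x ≢ suc p
  distinct x∈ refl with ∈-++⁻ (interval 0 p) (∈-resp-↭ rest (∈-++⁺ˡ x∈))
  ... | inj₁ in-low  = <-irrefl refl (proj₂ (interval-∈ 0 p in-low))
  ... | inj₂ in-high = <-irrefl refl (proj₁ (interval-∈ (suc p) q in-high))

-- Standardisation: if S ++ W is a permutation of [|S| + n], where n = |W|, some g relabels
-- the letters of S increasingly onto [|S|].  (Induction on n, deleting the letters of W.)
standardise : ∀ n W S → length W ≡ n → S ++ W ↭ interval 0 (length S + n) →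
  Σ (ℕ → ℕ) λ g → map g S ↭ interval 0 (length S) × MonoOn g S
standardise zero [] S _ perm = id , ↭-trans (↭-reflexive (trans (map-id S) (sym (++-identityʳ S))))
  (↭-trans perm (↭-reflexive (cong (interval 0) (+-identityʳ (length S))))) , λ _ _ x<y → x<y
standardise (suc n) (w ∷ W) S |W|≡ perm = g ∘ squeeze w , perm′ , mono
  where
  removed = remove-letter S W w (length S + n)
    (↭-trans perm (↭-reflexive (cong (interval 0) (+-suc (length S) n))))
  recursive = standardise n (map (squeeze w) W) (map (squeeze w) S)
    (trans (length-map (squeeze w) W) (suc-injective |W|≡))
    (↭-trans (↭-reflexive (sym (map-++ (squeeze w) S W)))
      (↭-trans (proj₁ removed) (↭-reflexive (cong (λ k → interval 0 (k + n)) (sym (length-map (squeeze w) S))))))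
  g = proj₁ recursive
  perm′ : map (g ∘ squeeze w) S ↭ interval 0 (length S)
  perm′ = ↭-trans (↭-reflexive (map-∘ S))
    (↭-trans (proj₁ (proj₂ recursive)) (↭-reflexive (cong (interval 0) (length-map (squeeze w) S))))
  mono : MonoOn (g ∘ squeeze w) S
  mono x∈ y∈ x<y = proj₂ (proj₂ recursive) (∈-map⁺ (squeeze w) x∈) (∈-map⁺ (squeeze w) y∈)
    (squeeze-mono (proj₂ (proj₂ removed)) (proj₁ (proj₂ removed) x∈) (proj₁ (proj₂ removed) y∈) x<y)

lift : ℕ → Ends → Ends
lift K e = record
  { first = K + first ; second = K + second ; inner = map (K +_) inner
  ; init = map (K +_) init ; penult = K + penult ; last = K + last
  ; frame = trans (cong (map (K +_)) frame) (map-++ (K +_) init _)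
  }
  where open Ends e

outside : Window → List ℕ
outside c = (A ++ a ∷ []) ++ b ∷ B
  where open Window c

word-↭ : ∀ c → Window.word c ↭ outside c ++ Ends.letters (Window.W c)
word-↭ c = ↭-trans (↭-reflexive (sym (++-assoc A (a ∷ []) _)))
  (↭-trans (++⁺ˡ (A ++ a ∷ []) (++-comm letters (b ∷ B))) (↭-reflexive (sym (++-assoc (A ++ a ∷ []) (b ∷ B) letters))))
  where open Window c; open Ends W

graft : (ℕ → ℕ) → ℕ → Window → Ends → Window
graft g K c τ = record { A = map g A ; a = g a ; W = lift K τ ; b = g b ; B = map g B }
  where open Window c

module _ (g : ℕ → ℕ) (K : ℕ) (c : Window) (τ : Ends) where
  private
    open Window c
    module τ = Ends τ
    c′ = graft g K c τ

  graft-↭ : Window.word c′ ↭ map g (outside c) ++ map (K +_) τ.letters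
  graft-↭ = ↭-trans (word-↭ c′) (↭-reflexive (cong (_++ map (K +_) τ.letters) (sym outside-map)))
    where
    outside-map : map g (outside c) ≡ outside c′
    outside-map = trans (map-++ g (A ++ a ∷ []) (b ∷ B)) (cong (_++ map g (b ∷ B)) (map-++ g A (a ∷ [])))

  graft-same : MonoOn g (outside c) → length τ.init ≡ length (Ends.init W) → SameOutside c′ c
  graft-same mono same-init = record
    { same-start   = length-map g A
    ; same-init    = trans (length-map (K +_) τ.init) same-init
    ; shape-before = trans (cong shape (sym (map-++ g A (a ∷ []))))
                           (shape-map g (A ++ a ∷ []) (λ x∈ y∈ → mono (∈-++⁺ˡ x∈) (∈-++⁺ˡ y∈)))
    ; shape-after  = shape-map g (b ∷ B) (λ x∈ y∈ → mono (∈-++⁺ʳ (A ++ a ∷ []) x∈) (∈-++⁺ʳ (A ++ a ∷ []) y∈))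
    }

  graft-peak-ends : (∀ {x} → x ∈ outside c → g x ≤ K) →
    τ.second < τ.first → τ.penult < τ.last → Window.PeakEnds c′
  graft-peak-ends g≤K second<first penult<last =
      (above-outside (∈-++⁺ˡ (∈-++⁺ʳ A (here refl))) second<first , +-monoʳ-< K second<first)
    , (+-monoʳ-< K penult<last , above-outside (∈-++⁺ʳ (A ++ a ∷ []) (here refl)) penult<last)
    where
    above-outside : ∀ {x y z} → x ∈ outside c → y < z → g x < K + z
    above-outside x∈ y<z = ≤-<-trans (g≤K x∈) (m<m+n K (≤-<-trans z≤n y<z))

  -- Lifting does not change the peaks inside the window.
  graft-mid : Window.mid c′ ≡ peaksFrom start τ.letters
  graft-mid = trans (cong (λ n → peaksFrom (suc (suc n)) (map (K +_) τ.letters)) (length-map g A))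
                    (peaks-shape start _ _ (shape-map (K +_) τ.letters (λ _ _ → +-monoʳ-< K)))

at-map : ∀ (f : ℕ → ℕ) l i → i < length l → at (map f l) i ≡ f (at l i)
at-map f (x ∷ l) zero    _         = refl
at-map f (x ∷ l) (suc i) (s≤s i<) = at-map f l i i<

orderIso-lift : ∀ K τ → OrderIso (map (K +_) τ) τ
orderIso-lift K τ = length-map (K +_) τ , λ i j i<j j< →
  let j<′ = subst (j <_) (length-map (K +_) τ) j<
      at-i = at-map (K +_) τ i (<-trans i<j j<′)
      at-j = at-map (K +_) τ j j<′
  in mk⇔ (λ lt → +-cancelˡ-< K _ _ (subst₂ _<_ at-i at-j lt))
         (λ lt → subst₂ _<_ (sym at-i) (sym at-j) (+-monoʳ-< K lt))

graft-window : ∀ c τ → Window.PeakEnds c → Ends.second τ < Ends.first τ → Ends.penult τ < Ends.last τ →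
  ∀ {N} → Window.word c ↭ interval 0 N →
  Ends.letters τ ↭ interval 0 (length (Ends.letters (Window.W c))) →
  Window.mid c ≡ peaksFrom (Window.start c) (Ends.letters τ) →
  Σ Window λ c′ → Window.word c′ ↭ interval 0 N
    × peakSet (Window.word c′) ≡ peakSet (Window.word c)
    × OrderIso (factor (Window.start c) (Window.end c) (Window.word c′)) (Ends.letters τ)
graft-window c τ peak-ends second<first penult<last {N} perm τ-perm mid≡ = c′ , perm′ , peaks≡ , iso
  where
  open Window c
  module τ = Ends τ
  module W = Ends W
  K = length (outside c)
  n = length W.letters
  total : N ≡ K + n
  total = trans (sym (length-interval 0 N)) (trans (↭-length (↭-sym perm))
            (trans (↭-length (word-↭ c)) (length-++ (outside c))))
  relabel = standardise n W.letters (outside c) refl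
    (↭-trans (↭-sym (word-↭ c)) (↭-trans perm (↭-reflexive (cong (interval 0) total))))
  g = proj₁ relabel
  g-perm : map g (outside c) ↭ interval 0 K
  g-perm = proj₁ (proj₂ relabel)
  g≤K : ∀ {x} → x ∈ outside c → g x ≤ K
  g≤K x∈ = proj₂ (interval-∈ 0 K (∈-resp-↭ g-perm (∈-map⁺ g x∈)))
  same-init : length τ.init ≡ length W.init
  same-init = suc-injective (suc-injective (trans (sym τ.length-letters)
    (trans (↭-length τ-perm) (trans (length-interval 0 n) W.length-letters))))
  c′ = graft g K c τ
  perm′ : Window.word c′ ↭ interval 0 N
  perm′ = ↭-trans (graft-↭ g K c τ) (↭-trans
    (↭-++⁺ g-perm (↭-trans (map⁺ (K +_) τ-perm) (↭-reflexive (interval-shift K 0 n))))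
    (↭-reflexive (begin
        interval 0 K ++ interval (K + 0) n
      ≡⟨ cong (λ b → interval 0 K ++ interval b n) (+-identityʳ K) ⟩
        interval 0 K ++ interval K n
      ≡⟨ sym (interval-++ 0 K n) ⟩
        interval 0 (K + n)
      ≡⟨ cong (interval 0) (sym total) ⟩
        interval 0 N
      ∎)))
    where open ≡-Reasoning
  same : SameOutside c′ c
  same = graft-same g K c τ (proj₂ (proj₂ relabel)) same-init
  peaks≡ : peakSet (Window.word c′) ≡ peakSet word
  peaks≡ = replace-window c′ c (graft-peak-ends g K c τ g≤K second<first penult<last) peak-ends same
    (trans (graft-mid g K c τ) (sym mid≡))
  start≡ : Window.start c′ ≡ start
  start≡ = cong (λ l → suc (suc l)) (SameOutside.same-start same)
  end≡ : Window.end c′ ≡ end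
  end≡ = cong suc (cong₂ _+_ start≡ (SameOutside.same-init same))
  iso : OrderIso (factor start end (Window.word c′)) τ.letters
  iso = subst (λ w → OrderIso w τ.letters)
    (trans (sym (factor-window c′)) (cong₂ (λ s e → factor s e (Window.word c′)) start≡ end≡))
    (orderIso-lift K τ.letters)

splitAt-length : ∀ m {n} (L : List ℕ) → length L ≡ m + n →
  Σ (List ℕ) λ X → Σ (List ℕ) λ Y → L ≡ X ++ Y × length X ≡ m × length Y ≡ n
splitAt-length zero    L       len = [] , L , refl , refl , len
splitAt-length (suc m) (x ∷ L) len with splitAt-length m L (suc-injective len)
... | X , Y , refl , |X| , |Y| = x ∷ X , Y , refl , cong suc |X| , |Y|

-- |σ| regrouped as |A| + (1 + |W| + 1 + |B|) for the window below.
regroup : ∀ m k r → suc (suc m) + (suc k + suc r) ≡ m + suc (suc (suc k) + suc r)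
regroup = solve-∀

window-at : ∀ {n₁ n₂ n₃} σ → 1 < n₁ → 0 < n₂ → 0 < n₃ → length σ ≡ n₁ + (n₂ + n₃) →
  Σ Window λ c → σ ≡ Window.word c × Window.start c ≡ n₁ × Window.end c ≡ n₁ + n₂
    × length (Ends.letters (Window.W c)) ≡ suc n₂
window-at {suc (suc m)} {suc k} {suc r} σ (s≤s (s≤s _)) (s≤s _) (s≤s _) len
  with splitAt-length m σ (trans len (regroup m k r))
... | A , a ∷ Y , refl , refl , |Y|
  with splitAt-length (suc (suc k)) Y (suc-injective |Y|)
... | first ∷ second ∷ inner , b ∷ B , refl , |W| , _
  with splitAt-length k (first ∷ second ∷ inner) (trans |W| (+-comm 2 k))
... | init , penult ∷ last ∷ [] , frame , refl , _ =
  record { A = A ; a = a ; W = W ; b = b ; B = B } , refl , refl , cong suc (sym (+-suc _ (length init))) , |W|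
  where
  W = framed first second inner init penult last frame

module _ (x₁ : ℕ) (d₁ : List ℕ) (y : ℕ) (d₂ : List ℕ) (z : ℕ) (d₃ : List ℕ) where
  private
    c₁ = x₁ ∷ d₁
    c₂ = y ∷ d₂
    c₃ = z ∷ d₃
    n₁ = sum c₁
    n₂ = sum c₂

  partialSums-three : partialSums 0 (c₁ ++ c₂ ++ c₃) ≡
    partialSums 0 c₁ ++ n₁ ∷ partialSums n₁ c₂ ++ n₁ + n₂ ∷ partialSums (n₁ + n₂) c₃
  partialSums-three = trans (partialSums-++ 0 x₁ d₁ y (d₂ ++ c₃))
    (cong (λ P → partialSums 0 c₁ ++ n₁ ∷ P) (partialSums-++ n₁ y d₂ z d₃))

  partialSums-three-banded : IsComposition c₁ → IsComposition c₂ → IsComposition c₃ →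
    Banded n₁ (n₁ + n₂) (partialSums 0 c₁) (n₁ ∷ []) (partialSums n₁ c₂) (n₁ + n₂ ∷ []) (partialSums (n₁ + n₂) c₃)
  partialSums-three-banded comp₁ comp₂ comp₃ = record
    { below   = All.map proj₂ (partialSums-bounds 0 c₁ comp₁)
    ; at-s    = refl ∷ []
    ; between = partialSums-bounds n₁ c₂ comp₂
    ; at-e    = refl ∷ []
    ; above   = All.map proj₁ (partialSums-bounds (n₁ + n₂) c₃ comp₃)
    }

  peakSet-three : ∀ σ → peakComp (sum (c₁ ++ c₂ ++ c₃)) σ ≡ c₁ ++ c₂ ++ c₃ →
    peakSet σ ≡ partialSums 0 c₁ ++ n₁ ∷ partialSums n₁ c₂ ++ n₁ + n₂ ∷ partialSums (n₁ + n₂) c₃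
  peakSet-three σ comp = trans (peakSet-of-peakComp _ σ _ comp) partialSums-three

  -- n₁ is a peak position, hence at least 2.
  n₁>1 : ∀ σ → peakComp (sum (c₁ ++ c₂ ++ c₃)) σ ≡ c₁ ++ c₂ ++ c₃ → 1 < n₁
  n₁>1 σ comp = All.lookup (peaks-above 1 σ) (subst (n₁ ∈_) (sym (peakSet-three σ comp)) (∈-++⁺ʳ _ (here refl)))

  sum-three : sum (c₁ ++ c₂ ++ c₃) ≡ n₁ + (n₂ + sum c₃)
  sum-three = trans (sum-++ c₁ _) (cong (n₁ +_) (sum-++ c₂ c₃))

  window-of-peaks : IsComposition c₁ → IsComposition c₂ → IsComposition c₃ → 0 < n₂ → 0 < sum c₃ →
    ∀ σ₀ → InP (c₁ ++ c₂ ++ c₃) σ₀ →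
    Σ Window λ c → σ₀ ≡ Window.word c × Window.start c ≡ n₁ × Window.end c ≡ n₁ + n₂
      × length (Ends.letters (Window.W c)) ≡ suc n₂ × Window.PeakEnds c × Window.mid c ≡ partialSums n₁ c₂
  window-of-peaks comp₁ comp₂ comp₃ n₂>0 n₃>0 σ₀ (perm , comp)
    with window-at σ₀ (n₁>1 σ₀ comp) n₂>0 n₃>0 (trans (perm-length perm) sum-three)
  ... | c , refl , start≡ , end≡ , |W| =
    let peak-ends , mid≡ = window-peaks c
          (subst₂ (λ s e → peakSet σ₀ ≡ partialSums 0 c₁ ++ s ∷ partialSums n₁ c₂ ++ e ∷ partialSums (n₁ + n₂) c₃)
                  (sym start≡) (sym end≡) (peakSet-three σ₀ comp))
          (subst₂ (λ s e → Banded s e (partialSums 0 c₁) (s ∷ []) (partialSums n₁ c₂) (e ∷ []) (partialSums (n₁ + n₂) c₃))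
                  (sym start≡) (sym end≡)
                  (partialSums-three-banded comp₁ comp₂ comp₃))
    in c , refl , start≡ , end≡ , |W| , peak-ends , mid≡

onePlus-peaks : ∀ k y d τ → peakComp (sum (onePlus (y ∷ d))) τ ≡ onePlus (y ∷ d) →
  peaksFrom (suc k) τ ≡ partialSums (suc k) (y ∷ d)
onePlus-peaks k y d τ comp = begin
    peaksFrom (suc k) τ
  ≡⟨ cong (λ i → peaksFrom i τ) (+-comm 1 k) ⟩
    peaksFrom (k + 1) τ
  ≡⟨ peaks-shift k 1 τ ⟩
    map (k +_) (peakSet τ)
  ≡⟨ cong (map (k +_)) (peakSet-of-peakComp _ τ _ comp) ⟩
    map (k +_) (partialSums 0 (suc y ∷ d))
  ≡⟨ partialSums-shift k 0 (suc y ∷ d) ⟩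
    partialSums (k + 0) (suc y ∷ d)
  ≡⟨ cong (λ o → partialSums o (suc y ∷ d)) (+-identityʳ k) ⟩
    partialSums k (suc y ∷ d)
  ≡⟨ partialSums-suc k y d ⟩
    partialSums (suc k) (y ∷ d)
  ∎
  where open ≡-Reasoning

lemma2p4 : (c₁ c₂ c₃ : List ℕ) →
    IsComposition c₁ → 0 < sum c₁ →
    IsComposition c₂ → 0 < sum c₂ →
    IsComposition c₃ → 0 < sum c₃ →
    Admissible (c₁ ++ c₂ ++ c₃) →
    (u v : ℕ) → (τ : List ℕ) → InInt u v (onePlus c₂) τ →
    ∃ λ σ → InP (c₁ ++ c₂ ++ c₃) σ
      × OrderIso (factor (sum c₁) (sum c₁ + sum c₂) σ) τ
lemma2p4 [] _ _ _ () _ _ _ _ _ _ _ _ _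
lemma2p4 (_ ∷ _) [] _ _ _ _ () _ _ _ _ _ _ _
lemma2p4 (_ ∷ _) (_ ∷ _) [] _ _ _ _ _ () _ _ _ _ _
lemma2p4 (x₁ ∷ d₁) (y ∷ d₂) (z ∷ d₃) comp₁ _ comp₂ n₂>0 comp₃ n₃>0 (σ₀ , σ₀-perm , σ₀-comp)
         u v τ ((τ-perm , τ-comp) , (t₂ , rest , refl , t₂<u) , (pre , p , frame , p<v)) =
  let c₀ , σ₀≡ , start≡ , end≡ , |W| , peak-ends , mid₀ =
        window-of-peaks x₁ d₁ y d₂ z d₃ comp₁ comp₂ comp₃ n₂>0 n₃>0 σ₀ (σ₀-perm , σ₀-comp)
      τ-mid = trans (onePlus-peaks _ y d₂ τ τ-comp) (cong (λ s → partialSums s (y ∷ d₂)) start≡)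
      c , perm , peaks≡ , iso =
        graft-window c₀ (framed u t₂ rest pre p v frame) peak-ends t₂<u p<v
          (subst (_↭ _) σ₀≡ (↭-trans σ₀-perm (↭-reflexive (upTo-interval _))))
          (↭-trans τ-perm (↭-reflexive (trans (upTo-interval _) (cong (interval 0) (sym |W|)))))
          (trans mid₀ (sym τ-mid))
  in Window.word c
     , (↭-trans perm (↭-reflexive (sym (upTo-interval _)))
       , trans (cong (λ P → diffs 0 P _) (trans peaks≡ (cong peakSet (sym σ₀≡)))) σ₀-comp)
     , subst₂ (λ s e → OrderIso (factor s e (Window.word c)) τ) start≡ end≡ iso
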